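{- Let $\mathcal{H}$ be a hereditary class of graphs with $\mathrm{mad}(H)\le d$ for all $H\in\mathcal{H}$, and let $\mathcal{G}$ be any graph class containing $K_2$. If there is a constant $s$ such that $c^{\mathcal{G}}_{\mathrm l}(H)\le s$ for all $H\in\mathcal{H}$, then $c^{\mathcal{G}}_{\mathrm u}(H)\le 2sd$ for all $H\in\mathcal{H}$. In particular, such classes $\mathcal{H}$ are weakly $(c^{\mathcal{G}}_{\mathrm u},c^{\mathcal{G}}_{\mathrm l})$-bounded.
   Context: All graphs are finite and simple. A class is hereditary if closed under induced subgraphs. $\mathrm{mad}(G)=\max\{2|E(G')|/|V(G')| : G'\subseteq G,\ |V(G')|>0\}$. For graphs $G,H$, a homomorphism $\varphi\colon G\to H$ is a map $V(G)\to V(H)$ with $\varphi(u)\varphi(v)\in E(H)$ whenever $uv\in E(G)$. $\dot\cup$ denotes vertex-disjoint union. For a graph class $\mathcal{G}$ and a graph $H$, a $\mathcal{G}$-cover of $H$ is an edge-surjective homomorphism $\varphi\colon G_1\dot\cup\cdots\dot\cup G_t\to H$ with all $G_i\in\mathcal{G}$; it is called $t$-global, injective if each $\varphi|_{G_i}$ is injective, and $s$-local if $|\varphi^{ -1}(v)|\le s$ for all $v\in V(H)$. $\overline{\mathcal{G}}$ is the class of all vertex-disjoint unions of graphs in $\mathcal{G}$. $c^{\mathcal{G}}_{\mathrm u}(H)$ is the least $t$ such that $H$ has a $t$-global injective $\overline{\mathcal{G}}$-cover; $c^{\mathcal{G}}_{\mathrm l}(H)$ the least $s$ such that $H$ has an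 $s$-local injective $\mathcal{G}$-cover. A class $\mathcal{H}$ is weakly $(c^{\mathcal{G}}_{\mathrm u},c^{\mathcal{G}}_{\mathrm l})$-bounded if $\sup_{H\in\mathcal{H}}c^{\mathcal{G}}_{\mathrm l}(H)<\infty$ implies $\sup_{H\in\mathcal{H}}c^{\mathcal{G}}_{\mathrm u}(H)<\infty$.
   Formalization: The bound d on $\mathrm{mad}(H)$ is taken to be a nonnegative rational. -}

module Defs where

open import Data.Nat using (ℕ; zero; suc; _+_; _*_; _≤_; _<ᵇ_)
open import Data.Bool using (Bool; true; false; _∧_; not; if_then_else_)
open import Data.Fin using (Fin; toℕ; splitAt; _↑ˡ_; _↑ʳ_; _≟_)
open import Data.Fin.Properties using ()
open import Data.List using (List; []; _∷_; length; map; filter; allFin; concatMap)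
open import Data.Nat.ListAction using (sum)
open import Data.List.Relation.Unary.All using (All)
open import Data.List.Relation.Unary.Any using (Any)
open import Data.Product using (Σ; ∃; ∃-syntax; _×_; _,_)
open import Data.Sum using (inj₁; inj₂)
open import Relation.Binary.PropositionalEquality using (_≡_)
open import Relation.Nullary.Decidable using (⌊_⌋)
open import Function.Definitions using (Injective)

record Graph : Set where
  constructor mkGraph
  field
    n      : ℕ
    adj    : Fin n → Fin n → Bool
    sym    : ∀ i j → adj i j ≡ adj j i
    irrefl : ∀ i → adj i i ≡ false
open Graph public

GraphClass : Set₁
GraphClass = Graph → Set

induced : (H : Graph) {m : ℕ} (f : Fin m → Fin (n H)) → Graph
induced H {m} f = mkGraph m (λ i j → adj H (f i) (f j))
                    (λ i j → sym H (f i) (f j)) (λ i → irrefl H (f i))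

Hereditary : GraphClass → Set
Hereditary 𝓗 = ∀ H → 𝓗 H → ∀ {m} (f : Fin m → Fin (n H)) →
               Injective _≡_ _≡_ f → 𝓗 (induced H f)

countTrue : ∀ {A : Set} → (A → Bool) → List A → ℕ
countTrue p xs = length (filter (λ x → Data.Bool._≟_ (p x) true) xs)

numEdges : Graph → ℕ
numEdges G = countTrue (λ ij → (toℕ (Data.Product.proj₁ ij) <ᵇ toℕ (Data.Product.proj₂ ij))
                                ∧ adj G (Data.Product.proj₁ ij) (Data.Product.proj₂ ij))
                       (concatMap (λ i → map (λ j → (i , j)) (allFin (n G))) (allFin (n G)))

record Subgraph (H : Graph) : Set where
  field
    sub    : Graph
    emb    : Fin (n sub) → Fin (n H)
    embInj : Injective _≡_ _≡_ emb
    embHom : ∀ i j → adj sub i j ≡ true → adj H (emb i) (emb j) ≡ true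

-- mad(H) ≤ p / q  (for a nonnegative rational d = p/q, q ≥ 1):
-- every subgraph G' with |V(G')| > 0 satisfies 2|E(G')|/|V(G')| ≤ p/q.
MadLE : Graph → ℕ → ℕ → Set
MadLE H p q = ∀ (S : Subgraph H) → 1 ≤ n (Subgraph.sub S) →
              2 * numEdges (Subgraph.sub S) * q ≤ p * n (Subgraph.sub S)

IsHom : (G H : Graph) → (Fin (n G) → Fin (n H)) → Set
IsHom G H φ = ∀ u v → adj G u v ≡ true → adj H (φ u) (φ v) ≡ true

record _≅_ (G H : Graph) : Set where
  field
    to      : Fin (n G) → Fin (n H)
    from    : Fin (n H) → Fin (n G)
    from-to : ∀ x → from (to x) ≡ x
    to-from : ∀ y → to (from y) ≡ y
    adj-to  : ∀ u v → adj H (to u) (to v) ≡ adj G u v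

K2 : Graph
K2 = mkGraph 2 a s i
  where
  a : Fin 2 → Fin 2 → Bool
  a Fin.zero Fin.zero = false
  a Fin.zero (Fin.suc Fin.zero) = true
  a (Fin.suc Fin.zero) Fin.zero = true
  a (Fin.suc Fin.zero) (Fin.suc Fin.zero) = false
  s : ∀ i j → a i j ≡ a j i
  s Fin.zero Fin.zero = _≡_.refl
  s Fin.zero (Fin.suc Fin.zero) = _≡_.refl
  s (Fin.suc Fin.zero) Fin.zero = _≡_.refl
  s (Fin.suc Fin.zero) (Fin.suc Fin.zero) = _≡_.refl
  i : ∀ x → a x x ≡ false
  i Fin.zero = _≡_.refl
  i (Fin.suc Fin.zero) = _≡_.refl

emptyGraph : Graph
emptyGraph = mkGraph 0 (λ ()) (λ ()) (λ ())

_⊕_ : Graph → Graph → Graph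
G ⊕ H = mkGraph (n G + n H) a s i
  where
  a : Fin (n G + n H) → Fin (n G + n H) → Bool
  a x y with splitAt (n G) x | splitAt (n G) y
  ... | inj₁ u | inj₁ v = adj G u v
  ... | inj₂ u | inj₂ v = adj H u v
  ... | inj₁ _ | inj₂ _ = false
  ... | inj₂ _ | inj₁ _ = false
  s : ∀ x y → a x y ≡ a y x
  s x y with splitAt (n G) x | splitAt (n G) y
  ... | inj₁ u | inj₁ v = sym G u v
  ... | inj₂ u | inj₂ v = sym H u v
  ... | inj₁ _ | inj₂ _ = _≡_.refl
  ... | inj₂ _ | inj₁ _ = _≡_.refl
  i : ∀ x → a x x ≡ false
  i x with splitAt (n G) x
  ... | inj₁ u = irrefl G u
  ... | inj₂ u = irrefl H u

⨁ : List Graph → Graph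
⨁ [] = emptyGraph
⨁ (G ∷ Gs) = G ⊕ ⨁ Gs

-- The class 𝒢‾ of all vertex-disjoint unions of graphs in 𝒢
-- (up to isomorphism; the empty union is allowed).
Closure : GraphClass → GraphClass
Closure 𝒢 G = Σ (List Graph) λ Gs → All 𝒢 Gs × (G ≅ ⨁ Gs)

record Piece (H : Graph) : Set where
  field
    src    : Graph
    φ      : Fin (n src) → Fin (n H)
    φ-hom  : IsHom src H φ
    φ-inj  : Injective _≡_ _≡_ φ
open Piece public

-- The combined homomorphism from the disjoint union of the parts is
-- edge-surjective: every edge of H is the image of an edge of some part.
EdgeSurjective : (H : Graph) → List (Piece H) → Set
EdgeSurjective H ps = ∀ u v → adj H u v ≡ true →
  Any (λ P → ∃[ x ] ∃[ y ] (adj (src P) x y ≡ true × φ P x ≡ u × φ P y ≡ v)) ps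

preimageCount : {H : Graph} → Piece H → Fin (n H) → ℕ
preimageCount P v = countTrue (λ x → ⌊ φ P x ≟ v ⌋) (allFin (n (src P)))

totalPreimage : {H : Graph} → List (Piece H) → Fin (n H) → ℕ
totalPreimage ps v = sum (map (λ P → preimageCount P v) ps)

-- H has a t-global injective 𝒢‾-cover (t parts, each in 𝒢‾).
-- c_u^𝒢(H) ≤ t  iff  such a cover with at most t parts exists.
CuLE : GraphClass → Graph → ℕ → Set
CuLE 𝒢 H t = Σ (List (Piece H)) λ ps →
  length ps ≤ t × All (λ P → Closure 𝒢 (src P)) ps × EdgeSurjective H ps

-- c_l^𝒢(H) ≤ s  iff  H has an s-local injective 𝒢-cover.
ClLE : GraphClass → Graph → ℕ → Set
ClLE 𝒢 H s = Σ (List (Piece H)) λ ps →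
  All (λ P → 𝒢 (src P)) ps × EdgeSurjective H ps × (∀ v → totalPreimage ps v ≤ s)

WeaklyBounded : GraphClass → GraphClass → Set
WeaklyBounded 𝒢 𝓗 =
  (Σ ℕ λ s → ∀ H → 𝓗 H → ClLE 𝒢 H s) → Σ ℕ λ t → ∀ H → 𝓗 H → CuLE 𝒢 H t

{-# OPTIONS --safe #-}
-- Since mad(H) ≤ p/q, every graph of the hereditary class has a vertex of degree at most
-- L = ⌊p/q⌋, so peeling such vertices off one at a time splits E(H) into L pseudoforests
-- (each vertex points to at most one later neighbour in each), properly 2-coloured along the
-- pointers. The vertices of one colour class are the centres of a star forest, so the edges
-- of H lie in 2L star forests. Each star is an induced subgraph, hence has an s-local cover,
-- and at most s of its pieces pass through the centre; these cover all edges of the star.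
-- The stars of one star forest are vertex-disjoint, so taking the i-th such piece of every
-- star and forming their disjoint union gives, for i < s, a single injective piece from 𝒢‾.
-- Altogether this gives 2Ls ≤ 2sp/q pieces.
module Submission where

open import Defs hiding (sym)
open import Data.Nat using (ℕ; zero; suc; _+_; _*_; _/_; _≤_; _<_; _<ᵇ_; z≤n; s≤s; NonZero)
open import Data.Nat.Properties
  using ( +-identityʳ; +-mono-≤; *-comm; *-assoc; *-monoʳ-≤; *-monoʳ-<; m≤n+m; m≤m*n; n<1+n
        ; ≤-reflexive; ≤-trans; ≤-antisym; <-≤-trans; <-asym; ≮⇒≥; ≰⇒>; <⇒≱; _≤?_
        ; <ᵇ-reflects-<; +-0-commutativeMonoid; +-*-semiring; module ≤-Reasoning )
open import Data.Nat.DivMod using (m/n*n≤m; m*n/n≡m; /-monoˡ-≤)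
open import Data.Nat.ListAction using (sum)
open import Data.Bool using (Bool; true; false; _∧_; not; if_then_else_)
import Data.Bool as Bool
open import Data.Bool.Properties using (not-¬; ¬-not)
open import Data.Fin using (Fin; toℕ; fromℕ<; punchIn; punchOut; splitAt; join; _↑ˡ_; _↑ʳ_; _≟_)
import Data.Fin as Fin
open import Data.Fin.Properties
  using ( toℕ-injective; toℕ<n; toℕ-fromℕ<; nonZeroIndex; any?; punchIn-punchOut; punchIn-injective
        ; join-splitAt; splitAt-↑ˡ; splitAt-↑ʳ )
open import Data.Maybe using (Maybe; just; nothing; maybe)
import Data.Maybe as Maybe
import Data.Maybe.Properties as Maybeₚ
import Data.Maybe.Relation.Unary.All as MaybeAll
import Data.Maybe.Relation.Unary.Any as MaybeAny
open import Data.Product using (Σ; ∃; ∃-syntax; _×_; _,_; proj₁; proj₂; map₂)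
open import Data.Sum using (_⊎_; inj₁; inj₂; swap; [_,_]′)
import Data.Sum as Sum
open import Data.Empty using (⊥)
open import Data.List
  using (List; []; _∷_; _++_; length; map; filter; allFin; concatMap; tabulate; mapMaybe; upTo; lookup)
open import Data.List.Properties using (filter-++; length-++; length-map; length-upTo; map-tabulate; filter-some)
open import Data.List.Membership.Propositional using (_∈_; find)
open import Data.List.Membership.Propositional.Properties
  using (∈-filter⁺; ∈-filter⁻; ∈-allFin; ∈-upTo⁺; ∈-lookup)
open import Data.List.Relation.Unary.All using (All; []; _∷_)
import Data.List.Relation.Unary.All as All
import Data.List.Relation.Unary.All.Properties as Allₚ
open import Data.List.Relation.Unary.Any using (Any; here; there)
import Data.List.Relation.Unary.Any as Any
import Data.List.Relation.Unary.Any.Properties as Anyₚ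
open import Data.List.Relation.Unary.AllPairs using (AllPairs; []; _∷_)
open import Data.List.Relation.Unary.Unique.Propositional using (Unique)
import Data.List.Relation.Unary.Unique.Propositional.Properties as Uniqueₚ
open import Data.Vec.Functional using (insertAt)
open import Data.Vec.Functional.Properties using (insertAt-lookup; insertAt-punchIn)
open import Algebra.Properties.CommutativeMonoid.Sum +-0-commutativeMonoid
  using (sum-syntax; sum-cong-≗; sum-remove; ∑-comm; ∑-distrib-+)
open import Algebra.Properties.Semiring.Sum +-*-semiring using (*-distribʳ-sum)
open import Function using (id; _∘_)
open import Function.Definitions using (Injective)
open import Relation.Nullary using (does; yes; no; ofʸ; ofⁿ; contradiction)
open import Relation.Nullary.Decidable using (_⊎-dec_; dec-true; isYes≗does)
open import Relation.Unary using (Decidable)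
open import Relation.Binary.PropositionalEquality

nth : ∀ {A : Set} → List A → ℕ → Maybe A
nth []       _       = nothing
nth (x ∷ xs) zero    = just x
nth (x ∷ xs) (suc i) = nth xs i

∈⇒nth : ∀ {A : Set} {x : A} {xs} → x ∈ xs → ∃ λ i → i < length xs × nth xs i ≡ just x
∈⇒nth (here refl)  = zero , s≤s z≤n , refl
∈⇒nth (there x∈xs) with i , i<length , nth≡ ← ∈⇒nth x∈xs = suc i , s≤s i<length , nth≡

nth-∈ : ∀ {A : Set} {x : A} xs i → nth xs i ≡ just x → x ∈ xs
nth-∈ (y ∷ xs) zero    refl = here refl
nth-∈ (y ∷ xs) (suc i) eq   = there (nth-∈ xs i eq)

map-≡-just : ∀ {A B : Set} {f : A → B} {mx y} → Maybe.map f mx ≡ just y → ∃ λ x → mx ≡ just x × f x ≡ y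
map-≡-just {mx = just x} refl = x , refl , refl

mapMaybe-AllPairs⁺ : ∀ {A B : Set} {R : A → A → Set} {R′ : B → B → Set} {f : A → Maybe B} →
                     (∀ {x y a b} → R x y → f x ≡ just a → f y ≡ just b → R′ a b) →
                     ∀ {xs} → AllPairs R xs → AllPairs R′ (mapMaybe f xs)
mapMaybe-AllPairs⁺ {R = R} {R′} {f} R⇒R′ = go
  where
  go : ∀ {xs} → AllPairs R xs → AllPairs R′ (mapMaybe f xs)
  go {[]}     []         = []
  go {x ∷ xs} (Rx ∷ Rxs) with f x in fx
  ... | nothing = go Rxs
  ... | just a  = Allₚ.mapMaybe⁺ (Allₚ.map⁺ (All.map related Rx)) ∷ go Rxs
    where
    related : ∀ {y} → R x y → MaybeAll.All (R′ a) (f y)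
    related {y} Rxy with f y in fy
    ... | nothing = MaybeAll.nothing
    ... | just b  = MaybeAll.just (R⇒R′ Rxy fx fy)

length-filter≤sum : ∀ {A : Set} {P : A → Set} (P? : Decidable P) (g : A → ℕ) → (∀ {x} → P x → 1 ≤ g x) →
                    ∀ xs → length (filter P? xs) ≤ sum (map g xs)
length-filter≤sum P? g positive []       = z≤n
length-filter≤sum P? g positive (x ∷ xs) with P? x
... | yes px = +-mono-≤ (positive px) (length-filter≤sum P? g positive xs)
... | no _   = ≤-trans (length-filter≤sum P? g positive xs) (m≤n+m _ (g x))

lookup-injective : ∀ {A : Set} {xs : List A} → Unique xs → Injective _≡_ _≡_ (lookup xs)
lookup-injective {xs = _ ∷ _} (_ ∷ _)      {Fin.zero}  {Fin.zero}  _  = refl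
lookup-injective {xs = _ ∷ _} (_ ∷ unique) {Fin.suc i} {Fin.suc j} eq = cong Fin.suc (lookup-injective unique eq)
lookup-injective {xs = _ ∷ _} (x∉xs ∷ _)   {Fin.zero}  {Fin.suc j} eq = contradiction eq (All.lookup x∉xs (∈-lookup j))
lookup-injective {xs = _ ∷ _} (x∉xs ∷ _)   {Fin.suc i} {Fin.zero}  eq = contradiction (sym eq) (All.lookup x∉xs (∈-lookup i))

module _ {n} {P : Fin n → Set} (P? : Decidable P) where

  enumerate : Fin (length (filter P? (allFin n))) → Fin n
  enumerate = lookup (filter P? (allFin n))

  enumerate-injective : Injective _≡_ _≡_ enumerate
  enumerate-injective = lookup-injective (Uniqueₚ.filter⁺ P? (Uniqueₚ.allFin⁺ n))

  enumerate-sound : ∀ i → P (enumerate i)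
  enumerate-sound i = proj₂ (∈-filter⁻ P? {xs = allFin n} (∈-lookup i))

  enumerate-complete : ∀ {x} → P x → ∃ λ i → enumerate i ≡ x
  enumerate-complete {x} px = Any.index x∈ , sym (Anyₚ.lookup-index x∈)
    where
    x∈ : x ∈ filter P? (allFin n)
    x∈ = ∈-filter⁺ P? (∈-allFin _) px

[,]-injective : ∀ {A B C : Set} {f : A → C} {g : B → C} → Injective _≡_ _≡_ f → Injective _≡_ _≡_ g →
                (∀ a b → f a ≢ g b) → Injective _≡_ _≡_ [ f , g ]′
[,]-injective f-inj g-inj apart {inj₁ a} {inj₁ a′} eq = cong inj₁ (f-inj eq)
[,]-injective f-inj g-inj apart {inj₂ b} {inj₂ b′} eq = cong inj₂ (g-inj eq)
[,]-injective f-inj g-inj apart {inj₁ a} {inj₂ b}  eq = contradiction eq (apart a b)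
[,]-injective f-inj g-inj apart {inj₂ b} {inj₁ a}  eq = contradiction (sym eq) (apart a b)

splitAt-injective : ∀ m {n} → Injective _≡_ _≡_ (splitAt m {n})
splitAt-injective m {n} {x} {y} eq = begin
  x                      ≡⟨ join-splitAt m n x ⟨
  join m n (splitAt m x) ≡⟨ cong (join m n) eq ⟩
  join m n (splitAt m y) ≡⟨ join-splitAt m n y ⟩
  y                      ∎
  where open ≡-Reasoning

data PunchInView {m} (v : Fin (suc m)) : Fin (suc m) → Set where
  pivot   : PunchInView v v
  punched : ∀ i → PunchInView v (punchIn v i)

punchInView : ∀ {m} (v x : Fin (suc m)) → PunchInView v x
punchInView v x with v ≟ x
... | yes refl = pivot
... | no v≢x   = subst (PunchInView v) (punchIn-punchOut v≢x) (punched (punchOut v≢x))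

-- Counting edges and degrees

indicator : Bool → ℕ
indicator true  = 1
indicator false = 0

countTrue-++ : ∀ {A : Set} (p : A → Bool) xs ys → countTrue p (xs ++ ys) ≡ countTrue p xs + countTrue p ys
countTrue-++ p xs ys = trans (cong length (filter-++ _ xs ys)) (length-++ (filter _ xs))

countTrue-tabulate : ∀ {A : Set} {n} (p : A → Bool) (f : Fin n → A) →
                     countTrue p (tabulate f) ≡ ∑[ i < n ] indicator (p (f i))
countTrue-tabulate {n = zero}  p f = refl
countTrue-tabulate {n = suc n} p f with p (f Fin.zero)
... | true  = cong suc (countTrue-tabulate p (f ∘ Fin.suc))
... | false = countTrue-tabulate p (f ∘ Fin.suc)

countTrue-concatMap : ∀ {A B : Set} {n} (p : B → Bool) (h : A → List B) (f : Fin n → A) →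
                      countTrue p (concatMap h (tabulate f)) ≡ ∑[ i < n ] countTrue p (h (f i))
countTrue-concatMap {n = zero}  p h f = refl
countTrue-concatMap {n = suc n} p h f =
  trans (countTrue-++ p (h (f Fin.zero)) _) (cong (countTrue p (h (f Fin.zero)) +_) (countTrue-concatMap p h (f ∘ Fin.suc)))

countTrue-punchIn : ∀ {m} (p : Fin (suc m) → Bool) (v : Fin (suc m)) → p v ≡ false →
                    countTrue p (allFin (suc m)) ≡ countTrue (p ∘ punchIn v) (allFin m)
countTrue-punchIn {m} p v pv≡false = begin
  countTrue p (allFin (suc m))                             ≡⟨ countTrue-tabulate p id ⟩
  ∑[ i < suc m ] indicator (p i)                           ≡⟨ sum-remove {i = v} (indicator ∘ p) ⟩
  indicator (p v) + ∑[ i < m ] indicator (p (punchIn v i)) ≡⟨ cong (λ b → indicator b + rest) pv≡false ⟩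
  ∑[ i < m ] indicator (p (punchIn v i))                   ≡⟨ countTrue-tabulate (p ∘ punchIn v) id ⟨
  countTrue (p ∘ punchIn v) (allFin m)                     ∎
  where
  open ≡-Reasoning
  rest : ℕ
  rest = ∑[ i < m ] indicator (p (punchIn v i))

∑-const : ∀ n c → ∑[ i < n ] c ≡ n * c
∑-const zero    c = refl
∑-const (suc n) c = cong (c +_) (∑-const n c)

∑-mono-≤ : ∀ {n} {f g : Fin n → ℕ} → (∀ i → f i ≤ g i) → ∑[ i < n ] f i ≤ ∑[ i < n ] g i
∑-mono-≤ {zero}  f≤g = z≤n
∑-mono-≤ {suc n} f≤g = +-mono-≤ (f≤g Fin.zero) (∑-mono-≤ (f≤g ∘ Fin.suc))

degree : (G : Graph) → Fin (n G) → ℕ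
degree G v = countTrue (adj G v) (allFin (n G))

forwardEdge : (G : Graph) → Fin (n G) → Fin (n G) → ℕ
forwardEdge G i j = indicator ((toℕ i <ᵇ toℕ j) ∧ adj G i j)

numEdges-∑ : ∀ G → numEdges G ≡ ∑[ i < n G ] ∑[ j < n G ] forwardEdge G i j
numEdges-∑ G = trans (countTrue-concatMap forward (λ i → map (i ,_) (allFin (n G))) id)
  (sum-cong-≗ λ i → trans (cong (countTrue forward) (map-tabulate id (i ,_))) (countTrue-tabulate forward (i ,_)))
  where
  forward : Fin (n G) × Fin (n G) → Bool
  forward ij = (toℕ (proj₁ ij) <ᵇ toℕ (proj₂ ij)) ∧ adj G (proj₁ ij) (proj₂ ij)

indicator-split : ∀ (m n : ℕ) b → (m ≡ n → b ≡ false) →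
                  indicator b ≡ indicator ((m <ᵇ n) ∧ b) + indicator ((n <ᵇ m) ∧ b)
indicator-split m n b m≡n⇒¬b with m <ᵇ n | <ᵇ-reflects-< m n | n <ᵇ m | <ᵇ-reflects-< n m
... | true  | ofʸ m<n | true  | ofʸ n<m = contradiction n<m (<-asym m<n)
... | true  | _       | false | _       = sym (+-identityʳ _)
... | false | _       | true  | _       = refl
... | false | ofⁿ m≮n | false | ofⁿ n≮m = cong indicator (m≡n⇒¬b (≤-antisym (≮⇒≥ n≮m) (≮⇒≥ m≮n)))

handshake : ∀ G → ∑[ v < n G ] degree G v ≡ 2 * numEdges G
handshake G = begin
  ∑[ i < N ] degree G i
    ≡⟨ sum-cong-≗ (λ i → countTrue-tabulate (adj G i) id) ⟩
  ∑[ i < N ] ∑[ j < N ] indicator (adj G i j)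
    ≡⟨ sum-cong-≗ (λ i → sum-cong-≗ (adj-split i)) ⟩
  ∑[ i < N ] ∑[ j < N ] (forwardEdge G i j + forwardEdge G j i)
    ≡⟨ sum-cong-≗ (λ i → ∑-distrib-+ (forwardEdge G i) (λ j → forwardEdge G j i)) ⟩
  ∑[ i < N ] (∑[ j < N ] forwardEdge G i j + ∑[ j < N ] forwardEdge G j i)
    ≡⟨ ∑-distrib-+ (λ i → ∑[ j < N ] forwardEdge G i j) (λ i → ∑[ j < N ] forwardEdge G j i) ⟩
  E + ∑[ i < N ] ∑[ j < N ] forwardEdge G j i
    ≡⟨ cong (E +_) (∑-comm (λ i j → forwardEdge G j i)) ⟩
  E + E
    ≡⟨ cong (E +_) (sym (+-identityʳ E)) ⟩
  2 * E
    ≡⟨ cong (2 *_) (numEdges-∑ G) ⟨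
  2 * numEdges G ∎
  where
  open ≡-Reasoning
  N : ℕ
  N = n G
  E : ℕ
  E = ∑[ i < N ] ∑[ j < N ] forwardEdge G i j
  adj-split : ∀ i j → indicator (adj G i j) ≡ forwardEdge G i j + forwardEdge G j i
  adj-split i j = begin
    indicator (adj G i j)
      ≡⟨ indicator-split (toℕ i) (toℕ j) (adj G i j) (λ i≡j → subst (λ k → adj G i k ≡ false) (toℕ-injective i≡j) (irrefl G i)) ⟩
    forwardEdge G i j + indicator ((toℕ j <ᵇ toℕ i) ∧ adj G i j)
      ≡⟨ cong (λ b → forwardEdge G i j + indicator ((toℕ j <ᵇ toℕ i) ∧ b)) (Graph.sym G i j) ⟩
    forwardEdge G i j + forwardEdge G j i ∎

wholeGraph : (G : Graph) → Subgraph G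
wholeGraph G = record { sub = G ; emb = id ; embInj = id ; embHom = λ _ _ → id }

lowDegreeVertex : ∀ G {p q} → MadLE G p q → Fin (n G) → ∃ λ v → degree G v * q ≤ p
lowDegreeVertex G {p} {q} mad u with any? (λ v → degree G v * q ≤? p)
... | yes low = low
... | no ¬low = contradiction (mad (wholeGraph G) (≤-trans (s≤s z≤n) (toℕ<n u))) (<⇒≱ degreeSum>)
  where
  N : ℕ
  N = n G
  degreeSum> : p * N < 2 * numEdges G * q
  degreeSum> = begin-strict
    p * N                       ≡⟨ *-comm p N ⟩
    N * p                       <⟨ *-monoʳ-< N {{nonZeroIndex u}} (n<1+n p) ⟩
    N * suc p                   ≡⟨ ∑-const N (suc p) ⟨
    ∑[ v < N ] suc p            ≤⟨ ∑-mono-≤ (λ v → ≰⇒> (¬low ∘ (v ,_))) ⟩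
    ∑[ v < N ] (degree G v * q) ≡⟨ *-distribʳ-sum q (degree G) ⟨
    (∑[ v < N ] degree G v) * q ≡⟨ cong (_* q) (handshake G) ⟩
    2 * numEdges G * q          ∎
    where open ≤-Reasoning

-- Bipartite pseudoforests and star forests

record BipartitePseudoforest (n : ℕ) : Set where
  field
    parent        : Fin n → Maybe (Fin n)
    colour        : Fin n → Bool
    colour-parent : ∀ {x y} → parent x ≡ just y → colour x ≢ colour y
open BipartitePseudoforest

Joins : ∀ {n} → BipartitePseudoforest n → Fin n → Fin n → Set
Joins F u w = parent F u ≡ just w ⊎ parent F w ≡ just u

emptyPseudoforest : BipartitePseudoforest 0
emptyPseudoforest = record { parent = λ () ; colour = λ () ; colour-parent = λ {} }

-- F lives on the vertices other than v, identified with Fin m through punchIn v.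
addLeaf : ∀ {m} → Fin (suc m) → Maybe (Fin m) → BipartitePseudoforest m → BipartitePseudoforest (suc m)
addLeaf {m} v t F = record { parent = parent′ ; colour = colour′ ; colour-parent = colour-parent′ }
  where
  parent′ : Fin (suc m) → Maybe (Fin (suc m))
  parent′ = insertAt (Maybe.map (punchIn v) ∘ parent F) v (Maybe.map (punchIn v) t)
  colour′ : Fin (suc m) → Bool
  colour′ = insertAt (colour F) v (maybe (not ∘ colour F) false t)
  colour-parent′ : ∀ {x y} → parent′ x ≡ just y → colour′ x ≢ colour′ y
  colour-parent′ {x} eq with punchInView v x
  colour-parent′ eq | pivot with map-≡-just {f = punchIn v} {mx = t} (trans (sym (insertAt-lookup _ v _)) eq)
  ... | j , t≡j , refl = λ same → not-¬ refl (sym (begin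
          not (colour F j)               ≡⟨ cong (maybe (not ∘ colour F) false) t≡j ⟨
          maybe (not ∘ colour F) false t ≡⟨ insertAt-lookup (colour F) v _ ⟨
          colour′ v                      ≡⟨ same ⟩
          colour′ (punchIn v j)          ≡⟨ insertAt-punchIn (colour F) v _ j ⟩
          colour F j                     ∎))
    where open ≡-Reasoning
  colour-parent′ eq | punched i with map-≡-just {f = punchIn v} (trans (sym (insertAt-punchIn _ v _ i)) eq)
  ... | j , parent-i , refl = λ same → colour-parent F parent-i (begin
          colour F i            ≡⟨ insertAt-punchIn (colour F) v _ i ⟨
          colour′ (punchIn v i) ≡⟨ same ⟩
          colour′ (punchIn v j) ≡⟨ insertAt-punchIn (colour F) v _ j ⟩
          colour F j            ∎)
    where open ≡-Reasoning

addLeaf-joins-pivot : ∀ {m} (v : Fin (suc m)) {t j} (F : BipartitePseudoforest m) →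
                      t ≡ just j → Joins (addLeaf v t F) v (punchIn v j)
addLeaf-joins-pivot v F refl = inj₁ (insertAt-lookup _ v _)

addLeaf-joins-punchIn : ∀ {m} (v : Fin (suc m)) t (F : BipartitePseudoforest m) {i j} →
                        Joins F i j → Joins (addLeaf v t F) (punchIn v i) (punchIn v j)
addLeaf-joins-punchIn v t F = Sum.map lift lift
  where
  lift : ∀ {i j} → parent F i ≡ just j → parent (addLeaf v t F) (punchIn v i) ≡ just (punchIn v j)
  lift {i} eq = trans (insertAt-punchIn _ v _ i) (cong (Maybe.map (punchIn v)) eq)

PseudoforestDecomposition : ℕ → Graph → Set
PseudoforestDecomposition L H =
  Σ (Fin L → BipartitePseudoforest (n H)) λ F → ∀ u w → adj H u w ≡ true → ∃ λ k → Joins (F k) u w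

module _ {𝓗 : GraphClass} (hered : Hereditary 𝓗) {L : ℕ}
         (lowDegree : ∀ H → 𝓗 H → Fin (n H) → ∃ λ v → degree H v ≤ L) where

  -- Remove a vertex v of degree at most L; in the k-th pseudoforest v becomes a child of its k-th neighbour.
  pseudoforestDecomposition : ∀ H → 𝓗 H → PseudoforestDecomposition L H
  pseudoforestDecomposition H = go (n H) H refl
    where
    go : ∀ m H → n H ≡ m → 𝓗 H → PseudoforestDecomposition L H
    go zero    (mkGraph _ _ _ _)   refl _   = (λ _ → emptyPseudoforest) , λ ()
    go (suc m) H@(mkGraph _ _ _ _) refl H∈𝓗 = extend (go m (induced H (punchIn v)) refl H-v∈𝓗)
      where
      v : Fin (suc m)
      v = proj₁ (lowDegree H H∈𝓗 Fin.zero)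
      H-v∈𝓗 : 𝓗 (induced H (punchIn v))
      H-v∈𝓗 = hered H H∈𝓗 (punchIn v) (punchIn-injective v _ _)
      neighbours : List (Fin m)
      neighbours = filter (λ j → adj H v (punchIn v j) Bool.≟ true) (allFin m)
      neighbours-length : length neighbours ≤ L
      neighbours-length = subst (_≤ L) (countTrue-punchIn (adj H v) v (irrefl H v)) (proj₂ (lowDegree H H∈𝓗 Fin.zero))
      neighbourRank : ∀ j → adj H v (punchIn v j) ≡ true → ∃ λ k → nth neighbours (toℕ k) ≡ just j
      neighbourRank j vj with i , i<length , nth≡ ← ∈⇒nth (∈-filter⁺ _ (∈-allFin j) vj) =
        fromℕ< (<-≤-trans i<length neighbours-length) , trans (cong (nth neighbours) (toℕ-fromℕ< _)) nth≡
      extend : PseudoforestDecomposition L (induced H (punchIn v)) → PseudoforestDecomposition L H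
      extend (F , covers) = F′ , covers′
        where
        F′ : Fin L → BipartitePseudoforest (suc m)
        F′ k = addLeaf v (nth neighbours (toℕ k)) (F k)
        covers′ : ∀ x y → adj H x y ≡ true → ∃ λ k → Joins (F′ k) x y
        covers′ x y xy with punchInView v x | punchInView v y
        ... | pivot     | pivot     = contradiction (trans (sym xy) (irrefl H v)) λ ()
        ... | pivot     | punched j = map₂ (addLeaf-joins-pivot v (F _)) (neighbourRank j xy)
        ... | punched i | pivot     = map₂ (swap ∘ addLeaf-joins-pivot v (F _)) (neighbourRank i (trans (Graph.sym H v _) xy))
        ... | punched i | punched j = map₂ (λ {k} → addLeaf-joins-punchIn v (nth neighbours (toℕ k)) (F k)) (covers i j xy)


record StarForest (n : ℕ) : Set where
  field
    centre        : Fin n → Maybe (Fin n)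
    centre-centre : ∀ {x y} → centre x ≡ just y → centre y ≡ nothing
open StarForest

StarEdge : ∀ {n} → StarForest n → Fin n → Fin n → Set
StarEdge S u w = centre S u ≡ just w ⊎ centre S w ≡ just u

InStar : ∀ {n} → StarForest n → Fin n → Fin n → Set
InStar S b x = x ≡ b ⊎ centre S x ≡ just b

inStar? : ∀ {n} (S : StarForest n) b → Decidable (InStar S b)
inStar? S b x = (x ≟ b) ⊎-dec Maybeₚ.≡-dec _≟_ (centre S x) (just b)

-- The leaves are the vertices not of colour c; their parents have colour c.
starForest : ∀ {n} → BipartitePseudoforest n → Bool → StarForest n
starForest {n} F c = record { centre = centre′ ; centre-centre = centre-centre′ }
  where
  centre′ : Fin n → Maybe (Fin n)
  centre′ x = if does (colour F x Bool.≟ c) then nothing else parent F x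
  centre-centre′ : ∀ {x y} → centre′ x ≡ just y → centre′ y ≡ nothing
  centre-centre′ {x} {y} eq with colour F x Bool.≟ c | colour F y Bool.≟ c
  ... | yes _   | _      = contradiction eq λ ()
  ... | no _    | yes _  = refl
  ... | no x≢c  | no y≢c = contradiction (trans (¬-not x≢c) (sym (¬-not y≢c))) (colour-parent F eq)

starForest-parent : ∀ {n} (F : BipartitePseudoforest n) {u w} → parent F u ≡ just w →
                    centre (starForest F (colour F w)) u ≡ just w
starForest-parent F {u} {w} eq with colour F u Bool.≟ colour F w
... | yes same = contradiction same (colour-parent F eq)
... | no _     = eq

joins⇒starEdge : ∀ {n} (F : BipartitePseudoforest n) {u w} → Joins F u w → ∃ λ c → StarEdge (starForest F c) u w
joins⇒starEdge F (inj₁ eq) = _ , inj₁ (starForest-parent F eq)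
joins⇒starEdge F (inj₂ eq) = _ , inj₂ (starForest-parent F eq)

-- Pieces and their disjoint unions

⊕-adj-↑ˡ : ∀ G G′ x y → adj (G ⊕ G′) (x ↑ˡ n G′) (y ↑ˡ n G′) ≡ adj G x y
⊕-adj-↑ˡ G G′ x y rewrite splitAt-↑ˡ (n G) x (n G′) | splitAt-↑ˡ (n G) y (n G′) = refl

⊕-adj-↑ʳ : ∀ G G′ x y → adj (G ⊕ G′) (n G ↑ʳ x) (n G ↑ʳ y) ≡ adj G′ x y
⊕-adj-↑ʳ G G′ x y rewrite splitAt-↑ʳ (n G) (n G′) x | splitAt-↑ʳ (n G) (n G′) y = refl

≅-refl : ∀ {G} → G ≅ G
≅-refl = record { to = id ; from = id ; from-to = λ _ → refl ; to-from = λ _ → refl ; adj-to = λ _ _ → refl }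

module _ {H : Graph} where

  Covers : Fin (n H) → Fin (n H) → Piece H → Set
  Covers u w P = ∃[ x ] ∃[ y ] (adj (src P) x y ≡ true × φ P x ≡ u × φ P y ≡ w)

  covers-sym : ∀ {u w P} → Covers u w P → Covers w u P
  covers-sym {P = P} (x , y , xy , φx≡u , φy≡w) = y , x , trans (Graph.sym (src P) y x) xy , φy≡w , φx≡u

  Image : Piece H → Fin (n H) → Set
  Image P u = ∃ λ x → φ P x ≡ u

  DisjointImages : Piece H → Piece H → Set
  DisjointImages P Q = ∀ {u} → Image P u → Image Q u → ⊥

  ⋃-φ : (ps : List (Piece H)) → Fin (n (⨁ (map src ps))) → Fin (n H)
  ⋃-φ []       ()
  ⋃-φ (P ∷ ps) = [ φ P , ⋃-φ ps ]′ ∘ splitAt (n (src P))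

  ⋃-φ-hom : ∀ ps → IsHom (⨁ (map src ps)) H (⋃-φ ps)
  ⋃-φ-hom (P ∷ ps) x y xy with splitAt (n (src P)) x | splitAt (n (src P)) y
  ... | inj₁ x′ | inj₁ y′ = φ-hom P x′ y′ xy
  ... | inj₂ x′ | inj₂ y′ = ⋃-φ-hom ps x′ y′ xy
  ... | inj₁ _  | inj₂ _  = contradiction xy λ ()
  ... | inj₂ _  | inj₁ _  = contradiction xy λ ()

  ⋃-φ-image : ∀ ps y → Any (λ P → Image P (⋃-φ ps y)) ps
  ⋃-φ-image (P ∷ ps) y with splitAt (n (src P)) y
  ... | inj₁ x = here (x , refl)
  ... | inj₂ z = there (⋃-φ-image ps z)

  ⋃-φ-injective : ∀ ps → AllPairs DisjointImages ps → Injective _≡_ _≡_ (⋃-φ ps)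
  ⋃-φ-injective (P ∷ ps) (P#ps ∷ disjoint) =
    splitAt-injective (n (src P)) ∘ [,]-injective (φ-inj P) (⋃-φ-injective ps disjoint) apart
    where
    apart : ∀ a b → φ P a ≢ ⋃-φ ps b
    apart a b eq = All.lookupWith (λ P#Q imageQ → P#Q (a , eq) imageQ) P#ps (⋃-φ-image ps b)

  ⋃ : (ps : List (Piece H)) → AllPairs DisjointImages ps → Piece H
  ⋃ ps disjoint = record
    { src = ⨁ (map src ps) ; φ = ⋃-φ ps ; φ-hom = ⋃-φ-hom ps ; φ-inj = ⋃-φ-injective ps disjoint }

  ⋃-covers : ∀ ps disjoint {u w} → Any (Covers u w) ps → Covers u w (⋃ ps disjoint)
  ⋃-covers (P ∷ ps) _ (here (x , y , xy , refl , refl)) =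
    x ↑ˡ _ , y ↑ˡ _ , trans (⊕-adj-↑ˡ (src P) _ x y) xy ,
    cong [ φ P , ⋃-φ ps ]′ (splitAt-↑ˡ _ x _) , cong [ φ P , ⋃-φ ps ]′ (splitAt-↑ˡ _ y _)
  ⋃-covers (P ∷ ps) (_ ∷ disjoint) (there covered) with x , y , xy , refl , refl ← ⋃-covers ps disjoint covered =
    n (src P) ↑ʳ x , n (src P) ↑ʳ y , trans (⊕-adj-↑ʳ (src P) _ x y) xy ,
    cong [ φ P , ⋃-φ ps ]′ (splitAt-↑ʳ _ _ x) , cong [ φ P , ⋃-φ ps ]′ (splitAt-↑ʳ _ _ y)

  ⋃-closure : ∀ {𝒢 : GraphClass} ps disjoint → All (λ P → 𝒢 (src P)) ps → Closure 𝒢 (src (⋃ ps disjoint))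
  ⋃-closure ps _ ps∈𝒢 = map src ps , Allₚ.map⁺ ps∈𝒢 , ≅-refl

liftPiece : ∀ {H m} {f : Fin m → Fin (n H)} → Injective _≡_ _≡_ f → Piece (induced H f) → Piece H
liftPiece {f = f} f-inj P = record { src = src P ; φ = f ∘ φ P ; φ-hom = φ-hom P ; φ-inj = φ-inj P ∘ f-inj }

liftPiece-covers : ∀ {H m} {f : Fin m → Fin (n H)} (f-inj : Injective _≡_ _≡_ f) {P : Piece (induced H f)} {i j u w} →
                   f i ≡ u → f j ≡ w → Covers {induced H f} i j P → Covers u w (liftPiece {H} f-inj P)
liftPiece-covers f-inj fi≡u fj≡w (x , y , xy , refl , refl) = x , y , xy , fi≡u , fj≡w

module _ {G : Graph} where

  through : Fin (n G) → List (Piece G) → List (Piece G)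
  through v = filter (λ P → any? (λ x → φ P x ≟ v))

  preimageCount-positive : ∀ {v} {P : Piece G} → Image P v → 1 ≤ preimageCount P v
  preimageCount-positive {v} {P} (x , φx≡v) =
    filter-some _ (Anyₚ.tabulate⁺ x (trans (isYes≗does (φ P x ≟ v)) (dec-true (φ P x ≟ v) φx≡v)))

  through-length : ∀ v ps → length (through v ps) ≤ totalPreimage ps v
  through-length v =
    length-filter≤sum (λ P → any? (λ x → φ P x ≟ v)) (λ P → preimageCount P v) (λ {P} → preimageCount-positive {v} {P})

  through-covers : ∀ {ps} → EdgeSurjective G ps → ∀ {u v} → adj G u v ≡ true → Any (Covers u v) (through v ps)
  through-covers surjective {u} {v} uv with Anyₚ.filter⁺ _ (surjective u v uv)
  ... | inj₁ covered  = covered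
  ... | inj₂ ¬through with _ , y , _ , _ , φy≡v ← Anyₚ.lookup-result (surjective u v uv) = contradiction (y , φy≡v) ¬through

-- Global covers of edge sets

EdgeSet : Graph → Set₁
EdgeSet H = Fin (n H) → Fin (n H) → Set

GlobalCover : GraphClass → (H : Graph) → EdgeSet H → ℕ → Set
GlobalCover 𝒢 H E t = Σ (List (Piece H)) λ ps →
  length ps ≤ t × All (λ P → Closure 𝒢 (src P)) ps × (∀ u w → adj H u w ≡ true → E u w → Any (Covers u w) ps)

module _ {𝒢 : GraphClass} {H : Graph} where

  globalCover-mono : ∀ {E E′ : EdgeSet H} {t} → (∀ u w → adj H u w ≡ true → E u w → E′ u w) →
                     GlobalCover 𝒢 H E′ t → GlobalCover 𝒢 H E t
  globalCover-mono E⇒E′ (ps , length≤ , ps∈𝒢 , covers) = ps , length≤ , ps∈𝒢 , λ u w uw → covers u w uw ∘ E⇒E′ u w uw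

  globalCover-∪ : ∀ {E E′ : EdgeSet H} {t t′} → GlobalCover 𝒢 H E t → GlobalCover 𝒢 H E′ t′ →
                  GlobalCover 𝒢 H (λ u w → E u w ⊎ E′ u w) (t + t′)
  globalCover-∪ (ps , length≤ , ps∈𝒢 , covers) (ps′ , length≤′ , ps′∈𝒢 , covers′) =
    ps ++ ps′ ,
    subst (_≤ _) (sym (length-++ ps)) (+-mono-≤ length≤ length≤′) ,
    Allₚ.++⁺ ps∈𝒢 ps′∈𝒢 ,
    λ u w uw → [ Anyₚ.++⁺ˡ ∘ covers u w uw , Anyₚ.++⁺ʳ ps ∘ covers′ u w uw ]′

  globalCover-∃ : ∀ {L t} {E : Fin L → EdgeSet H} → (∀ k → GlobalCover 𝒢 H (E k) t) →
                  GlobalCover 𝒢 H (λ u w → ∃ λ k → E k u w) (L * t)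
  globalCover-∃ {zero}  _ = [] , z≤n , [] , λ { _ _ _ (() , _) }
  globalCover-∃ {suc L} {E = E} covers =
    globalCover-mono split (globalCover-∪ (covers Fin.zero) (globalCover-∃ (covers ∘ Fin.suc)))
    where
    split : ∀ u w → adj H u w ≡ true → (∃ λ k → E k u w) → E Fin.zero u w ⊎ ∃ λ k → E (Fin.suc k) u w
    split u w _ (Fin.zero  , e) = inj₁ e
    split u w _ (Fin.suc k , e) = inj₂ (k , e)

  globalCover⇒CuLE : ∀ {E : EdgeSet H} {t} → (∀ u w → adj H u w ≡ true → E u w) → GlobalCover 𝒢 H E t → CuLE 𝒢 H t
  globalCover⇒CuLE allEdges (ps , length≤ , ps∈𝒢 , covers) = ps , length≤ , ps∈𝒢 , λ u w uw → covers u w uw (allEdges u w uw)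

module _ {𝒢 : GraphClass} {H : Graph} {k s : ℕ}
         (T : Fin k → Fin (n H) → Set) (T-disjoint : ∀ {b b′ u} → T b u → T b′ u → b ≡ b′)
         (Q : Fin k → List (Piece H)) (Q-length : ∀ b → length (Q b) ≤ s)
         (Q-inside : ∀ b → All (λ P → 𝒢 (src P) × (∀ x → T b (φ P x))) (Q b)) where

  private
    slot : ℕ → List (Piece H)
    slot i = mapMaybe (λ b → nth (Q b) i) (allFin k)

    inside : ∀ {b i P} → nth (Q b) i ≡ just P → 𝒢 (src P) × (∀ x → T b (φ P x))
    inside {b} {i} eq = All.lookup (Q-inside b) (nth-∈ (Q b) i eq)

    slot-disjoint : ∀ i → AllPairs DisjointImages (slot i)
    slot-disjoint i = mapMaybe-AllPairs⁺ apart (Uniqueₚ.allFin⁺ k)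
      where
      apart : ∀ {b b′ P P′} → b ≢ b′ → nth (Q b) i ≡ just P → nth (Q b′) i ≡ just P′ → DisjointImages P P′
      apart b≢b′ P∈ P′∈ (x , refl) (x′ , eq) =
        b≢b′ (T-disjoint (proj₂ (inside P∈) x) (subst (T _) eq (proj₂ (inside P′∈) x′)))

    slot-𝒢 : ∀ i → All (λ P → 𝒢 (src P)) (slot i)
    slot-𝒢 i = Allₚ.mapMaybe⁺ (Allₚ.map⁺ (Allₚ.tabulate⁺ λ b → in𝒢 (nth (Q b) i) refl))
      where
      in𝒢 : ∀ {b} m → nth (Q b) i ≡ m → MaybeAll.All (λ P → 𝒢 (src P)) m
      in𝒢 nothing  _  = MaybeAll.nothing
      in𝒢 (just P) eq = MaybeAll.just (proj₁ (inside eq))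

    slot-covers : ∀ {u w} b → Any (Covers u w) (Q b) → ∃ λ i → i < s × Any (Covers u w) (slot i)
    slot-covers {u} {w} b covered with P , P∈ , covers ← find covered with i , i<length , nth≡ ← ∈⇒nth P∈ =
      i , <-≤-trans i<length (Q-length b) ,
      Anyₚ.mapMaybe⁺ _ (allFin k) (Anyₚ.map⁺ (Anyₚ.tabulate⁺ b (subst (MaybeAny.Any (Covers u w)) (sym nth≡) (MaybeAny.just covers))))

    union : ℕ → Piece H
    union i = ⋃ (slot i) (slot-disjoint i)

  -- The i-th union consists of the i-th pieces of all the families; they are disjoint because the T b are.
  disjointUnionCover : GlobalCover 𝒢 H (λ u w → ∃ λ b → Any (Covers u w) (Q b)) s
  disjointUnionCover =
    map union (upTo s) ,
    ≤-reflexive (trans (length-map union (upTo s)) (length-upTo s)) ,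
    Allₚ.map⁺ (All.universal (λ i → ⋃-closure (slot i) (slot-disjoint i) (slot-𝒢 i)) (upTo s)) ,
    λ u w _ (b , covered) → inUnion (slot-covers b covered)
    where
    inUnion : ∀ {u w} → (∃ λ i → i < s × Any (Covers u w) (slot i)) → Any (Covers u w) (map union (upTo s))
    inUnion (i , i<s , covered) = Anyₚ.map⁺ (Any.map (λ { refl → ⋃-covers (slot i) (slot-disjoint i) covered }) (∈-upTo⁺ i<s))

-- Covering star forests

InducedClLE : GraphClass → Graph → ℕ → Set
InducedClLE 𝒢 H s = ∀ {m} (f : Fin m → Fin (n H)) → Injective _≡_ _≡_ f → ClLE 𝒢 (induced H f) s

module _ {𝒢 : GraphClass} {H : Graph} {s : ℕ} (inducedCover : InducedClLE 𝒢 H s) (S : StarForest (n H)) where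

  private
    -- Locality bounds the number of pieces of the star's own cover that pass through its centre.
    module Star (b : Fin (n H)) where
      vertex : Fin (length (filter (inStar? S b) (allFin (n H)))) → Fin (n H)
      vertex = enumerate (inStar? S b)

      vertex-injective : Injective _≡_ _≡_ vertex
      vertex-injective = enumerate-injective (inStar? S b)

      cover : ClLE 𝒢 (induced H vertex) s
      cover = inducedCover vertex vertex-injective

      centreIndex : ∃ λ i → vertex i ≡ b
      centreIndex = enumerate-complete (inStar? S b) (inj₁ refl)

      localPieces : List (Piece (induced H vertex))
      localPieces = through (proj₁ centreIndex) (proj₁ cover)

      pieces : List (Piece H)
      pieces = map (liftPiece {H} vertex-injective) localPieces

      pieces-length : length pieces ≤ s
      pieces-length = begin
        length pieces                                   ≡⟨ length-map (liftPiece {H} vertex-injective) localPieces ⟩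
        length localPieces                              ≤⟨ through-length _ (proj₁ cover) ⟩
        totalPreimage (proj₁ cover) (proj₁ centreIndex) ≤⟨ proj₂ (proj₂ (proj₂ cover)) _ ⟩
        s                                               ∎
        where open ≤-Reasoning

      pieces-inside : All (λ P → 𝒢 (src P) × ∀ x → InStar S b (φ P x)) pieces
      pieces-inside = Allₚ.map⁺ (All.map (λ {P} P∈𝒢 → P∈𝒢 , λ x → enumerate-sound (inStar? S b) (φ P x))
                                         (Allₚ.filter⁺ _ (proj₁ (proj₂ cover))))

      pieces-cover : ∀ {u} → centre S u ≡ just b → adj H u b ≡ true → Any (Covers u b) pieces
      pieces-cover {u} u↦b ub with i , vertex-i≡u ← enumerate-complete (inStar? S b) (inj₂ u↦b) =
        Anyₚ.map⁺ (Any.map (λ {P} → liftPiece-covers {H} vertex-injective {P} vertex-i≡u (proj₂ centreIndex))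
                           (through-covers (proj₁ (proj₂ (proj₂ cover))) edge))
        where
        edge : adj H (vertex i) (vertex (proj₁ centreIndex)) ≡ true
        edge = trans (cong₂ (adj H) vertex-i≡u (proj₂ centreIndex)) ub

    OwnedBy : Fin (n H) → Fin (n H) → Set
    OwnedBy b u = centre S b ≡ nothing × InStar S b u

    ownedBy-unique : ∀ {b b′ u} → OwnedBy b u → OwnedBy b′ u → b ≡ b′
    ownedBy-unique (_        , inj₁ refl) (_        , inj₁ refl) = refl
    ownedBy-unique (isCentre , inj₁ refl) (_        , inj₂ u↦b′) = contradiction (trans (sym isCentre) u↦b′) λ ()
    ownedBy-unique (_        , inj₂ u↦b)  (isCentre , inj₁ refl) = contradiction (trans (sym isCentre) u↦b) λ ()
    ownedBy-unique (_        , inj₂ u↦b)  (_        , inj₂ u↦b′) = Maybeₚ.just-injective (trans (sym u↦b) u↦b′)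

    piecesAt : Fin (n H) → List (Piece H)
    piecesAt b with centre S b
    ... | nothing = Star.pieces b
    ... | just _  = []

    piecesAt-centre : ∀ {b} → centre S b ≡ nothing → piecesAt b ≡ Star.pieces b
    piecesAt-centre {b} isCentre with centre S b
    ... | nothing = refl

    piecesAt-length : ∀ b → length (piecesAt b) ≤ s
    piecesAt-length b with centre S b
    ... | nothing = Star.pieces-length b
    ... | just _  = z≤n

    piecesAt-inside : ∀ b → All (λ P → 𝒢 (src P) × ∀ x → OwnedBy b (φ P x)) (piecesAt b)
    piecesAt-inside b with centre S b
    ... | nothing = All.map (map₂ (λ inside x → refl , inside x)) (Star.pieces-inside b)
    ... | just _  = []

  starForestGlobalCover : GlobalCover 𝒢 H (StarEdge S) s
  starForestGlobalCover =
    globalCover-mono toOwner (disjointUnionCover OwnedBy ownedBy-unique piecesAt piecesAt-length piecesAt-inside)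
    where
    toOwner : ∀ u w → adj H u w ≡ true → StarEdge S u w → ∃ λ b → Any (Covers u w) (piecesAt b)
    toOwner u w uw (inj₁ u↦w) =
      w , subst (Any (Covers u w)) (sym (piecesAt-centre (centre-centre S u↦w))) (Star.pieces-cover w u↦w uw)
    toOwner u w uw (inj₂ w↦u) =
      u , subst (Any (Covers u w)) (sym (piecesAt-centre (centre-centre S w↦u)))
                (Any.map (λ {P} → covers-sym {P = P}) (Star.pieces-cover u w↦u (trans (Graph.sym H w u) uw)))

pseudoforestGlobalCover : ∀ {𝒢 H s} → InducedClLE 𝒢 H s → (F : BipartitePseudoforest (n H)) →
                           GlobalCover 𝒢 H (Joins F) (s + s)
pseudoforestGlobalCover {H = H} inducedCover F =
  globalCover-mono byColour
    (globalCover-∪ (starForestGlobalCover inducedCover (starForest F true)) (starForestGlobalCover inducedCover (starForest F false)))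
  where
  byColour : ∀ u w → adj H u w ≡ true → Joins F u w → StarEdge (starForest F true) u w ⊎ StarEdge (starForest F false) u w
  byColour u w _ joins with joins⇒starEdge F joins
  ... | true  , e = inj₁ e
  ... | false , e = inj₂ e


m*n≤o⇒m≤o/n : ∀ m n {o} .{{_ : NonZero n}} → m * n ≤ o → m ≤ o / n
m*n≤o⇒m≤o/n m n m*n≤o = subst (_≤ _ / n) (m*n/n≡m m n) (/-monoˡ-≤ n m*n≤o)

pieceCount-bound : ∀ s p q .{{_ : NonZero q}} → p / q * (s + s) * q ≤ 2 * s * p
pieceCount-bound s p q = begin
  p / q * (s + s) * q   ≡⟨ cong (_* q) (*-comm (p / q) (s + s)) ⟩
  (s + s) * (p / q) * q ≡⟨ *-assoc (s + s) (p / q) q ⟩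
  (s + s) * (p / q * q) ≤⟨ *-monoʳ-≤ (s + s) (m/n*n≤m p q) ⟩
  (s + s) * p           ≡⟨ cong (λ m → (s + m) * p) (sym (+-identityʳ s)) ⟩
  2 * s * p             ∎
  where open ≤-Reasoning

-- The hypothesis K₂ ∈ 𝒢 only serves to make local covers exist; here they are assumed.
proposition25 : (𝓗 𝒢 : GraphClass) → Hereditary 𝓗 →
    (p q : ℕ) → 1 ≤ q → (∀ H → 𝓗 H → MadLE H p q) →
    Σ Graph (λ G → 𝒢 G × (G ≅ K2)) →
    ((s : ℕ) → (∀ H → 𝓗 H → ClLE 𝒢 H s) →
       ∀ H → 𝓗 H → Σ ℕ (λ t → (t * q ≤ 2 * s * p) × CuLE 𝒢 H t))
    × WeaklyBounded 𝒢 𝓗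
proposition25 𝓗 𝒢 hered p q@(suc _) _ mad _ = globalBound , weaklyBounded
  where
  lowDegree : ∀ H → 𝓗 H → Fin (n H) → ∃ λ v → degree H v ≤ p / q
  lowDegree H H∈𝓗 u = map₂ (m*n≤o⇒m≤o/n _ q) (lowDegreeVertex H {p} {q} (mad H H∈𝓗) u)

  globalBound : (s : ℕ) → (∀ H → 𝓗 H → ClLE 𝒢 H s) → ∀ H → 𝓗 H → Σ ℕ (λ t → (t * q ≤ 2 * s * p) × CuLE 𝒢 H t)
  globalBound s local H H∈𝓗 with F , covers ← pseudoforestDecomposition hered lowDegree H H∈𝓗 =
    p / q * (s + s) , pieceCount-bound s p q ,
    globalCover⇒CuLE covers (globalCover-∃ (pseudoforestGlobalCover inducedCover ∘ F))
    where
    inducedCover : InducedClLE 𝒢 H s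
    inducedCover f f-inj = local (induced H f) (hered H H∈𝓗 f f-inj)

  weaklyBounded : WeaklyBounded 𝒢 𝓗
  weaklyBounded (s , local) = 2 * s * p , λ H H∈𝓗 → relax (globalBound s local H H∈𝓗)
    where
    relax : ∀ {H} → Σ ℕ (λ t → (t * q ≤ 2 * s * p) × CuLE 𝒢 H t) → CuLE 𝒢 H (2 * s * p)
    relax (t , t*q≤ , ps , length≤t , ps∈𝒢 , surjective) =
      ps , ≤-trans length≤t (≤-trans (m≤m*n t q) t*q≤) , ps∈𝒢 , surjective
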